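{- Let $p$ be a prime and let $\mathcal{E}$ be a collection of coefficient functions (containing the zero function and all $\beta^i$) such that $\epsilon_k<p$ for all $k\ge1$ and all $\epsilon\in\mathcal{E}$. Let $Q$ and $Z$ be decreasing sequences in $\mathbb{Z}_p$ with $X_Q=X_Z$. Then $\mathrm{ord}_p(Q_k)=\mathrm{ord}_p(Z_k)$ for all $k\ge1$.
   Context: A coefficient function is a map $\epsilon:\{1,2,\dots\}\to\{0,1,2,\dots\}$; $\beta^i$ has $\beta^i_i=1$ and $0$ elsewhere; $\sum\epsilon Q=\sum_{k\ge1}\epsilon_kQ_k$. A sequence $Q$ in the $p$-adic integers $\mathbb{Z}_p$ is decreasing if $|Q_k|_p>|Q_{k+1}|_p$ for all $k$ (so these sums converge). $X_Q=\{\sum\delta Q:\delta\in\mathcal{E},\delta\ne0\}$. $\mathrm{ord}_p$ denotes the $p$-adic valuation. -}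

module Defs where

open import Data.Nat using (ℕ; zero; suc; _+_; _*_; _^_; _<_; _≤_; NonZero)
open import Data.Nat.Properties using (m^n≢0)
open import Data.Nat.DivMod using (_%_)
open import Data.Nat.Divisibility using (_∣_)
open import Data.Product using (Σ; _×_)
open import Relation.Binary.PropositionalEquality using (_≡_)
open import Relation.Nullary using (¬_)

-- p-adic integers, represented as compatible systems of residues:
-- x = (res 0, res 1, ...) with res n ∈ [0, p^n) and res (n+1) ≡ res n (mod p^n).
record ℤ[_] (p : ℕ) .{{_ : NonZero p}} : Set where
  field
    res     : ℕ → ℕ
    res-lt  : ∀ n → res n < p ^ n
    res-coh : ∀ n → _%_ (res (suc n)) (p ^ n) {{m^n≢0 p n}} ≡ res n
open ℤ[_] public

module _ {p : ℕ} .{{_ : NonZero p}} where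

  _∣ₚ_ : ℕ → ℤ[ p ] → Set
  m ∣ₚ x = p ^ m ∣ res x m

  HasOrd : ℤ[ p ] → ℕ → Set
  HasOrd x m = (m ∣ₚ x) × ¬ (suc m ∣ₚ x)

  -- |x|_p > |y|_p  iff  x ≠ 0 and ord_p y > ord_p x (with ord 0 = ∞)
  AbsGt : ℤ[ p ] → ℤ[ p ] → Set
  AbsGt x y = Σ ℕ λ m → HasOrd x m × (suc m ∣ₚ y)

  -- Sequences are indexed from 0 here: Q k (Agda) is Q_{k+1} (paper).
  Decreasing : (ℕ → ℤ[ p ]) → Set
  Decreasing Q = ∀ k → AbsGt (Q k) (Q (suc k))

  sumBelow : ℕ → (ℕ → ℕ) → ℕ
  sumBelow zero    f = 0
  sumBelow (suc n) f = sumBelow n f + f n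

  -- For a decreasing Q, ord_p Q_k ≥ k (0-indexed),
  -- so only the terms k < n contribute modulo p^n; hence this is exactly
  -- (Σ ε Q) mod p^n for the convergent p-adic series.
  seriesRes : (ℕ → ℕ) → (ℕ → ℤ[ p ]) → ℕ → ℕ
  seriesRes ε Q n = _%_ (sumBelow n (λ k → ε k * res (Q k) n)) (p ^ n) {{m^n≢0 p n}}

  SeriesEq : (ℕ → ℕ) → (ℕ → ℤ[ p ]) → (ℕ → ℕ) → (ℕ → ℤ[ p ]) → Set
  SeriesEq δ Q δ' Z = ∀ n → seriesRes δ Q n ≡ seriesRes δ' Z n

  XSubset : ((ℕ → ℕ) → Set) → (ℕ → ℤ[ p ]) → (ℕ → ℤ[ p ]) → Set
  XSubset E Q Z = ∀ δ → E δ → ¬ (∀ k → δ k ≡ 0) →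
    Σ (ℕ → ℕ) λ δ' → E δ' × ¬ (∀ k → δ' k ≡ 0) × SeriesEq δ Q δ' Z

β : ℕ → ℕ → ℕ
β zero    zero    = 1
β zero    (suc k) = 0
β (suc i) zero    = 0
β (suc i) (suc k) = β i k

{-# OPTIONS --safe #-}
module Submission where

-- Q i is the series Σ β^i Q, so it lies in X_Q = X_Z and equals some Σ δ Z with δ ≠ 0 in E.
-- Because the orders of the Z k strictly increase and the leading coefficient δ j is a unit
-- mod p, the series Σ δ Z has order exactly ord (Z j). Thus the strictly increasing sequences
-- of orders of Q and of Z have the same image, so they coincide. Constructively the leading
-- index only exists under a double negation, which is harmless since equality of orders is
-- decidable.

open import Defs
open import Data.Nat using (ℕ; zero; suc; _*_; _^_; _<_; _≤_; _≤′_; ≤′-refl; ≤′-step; NonZero; ≢-nonZero; _<?_; z≤n; s≤s)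
open import Data.Nat.Properties
open import Data.Nat.DivMod using (_%_; m<n⇒m%n≡m; m∣n⇒o%n%m≡o%m)
open import Data.Nat.Divisibility
open import Data.Nat.Induction using (<-rec)
open import Data.Nat.Primality using (Prime; euclidsLemma)
open import Data.Product using (∃; ∃-syntax; _×_; _,_; proj₁; proj₂)
open import Data.Sum using (inj₁; inj₂)
open import Relation.Binary.PropositionalEquality using (_≡_; _≢_; refl; sym; trans; cong; subst; module ≡-Reasoning)
open import Relation.Nullary using (¬_; yes; no; contradiction)
open import Relation.Nullary.Decidable using (decidable-stable)
open import Function.Bundles using (_⇔_; mk⇔; Equivalence)
open import Function.Base using (_∘_)

private
  variable
    i j k m n : ℕ

StrictlyIncreasing : (ℕ → ℕ) → Set
StrictlyIncreasing f = ∀ k → f k < f (suc k)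

module _ {f : ℕ → ℕ} (f↑ : StrictlyIncreasing f) where

  strictlyIncreasing-< : i < j → f i < f j
  strictlyIncreasing-< i<j = go (≤⇒≤′ i<j)
    where
    go : suc i ≤′ j → f i < f j
    go ≤′-refl = f↑ _
    go (≤′-step i<j) = <-trans (go i<j) (f↑ _)

  strictlyIncreasing-≤ : i ≤ j → f i ≤ f j
  strictlyIncreasing-≤ i≤j with m≤n⇒m<n∨m≡n i≤j
  ... | inj₁ i<j = <⇒≤ (strictlyIncreasing-< i<j)
  ... | inj₂ refl = ≤-refl

  strictlyIncreasing-≥id : ∀ n → n ≤ f n
  strictlyIncreasing-≥id zero = z≤n
  strictlyIncreasing-≥id (suc n) = ≤-trans (s≤s (strictlyIncreasing-≥id n)) (f↑ n)

-- If a k were below b k, its preimage b j would have to lie before k, where a and b agree.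
strictlyIncreasing-≮ : {a b : ℕ → ℕ} → StrictlyIncreasing a → StrictlyIncreasing b →
                       (∀ {i} → i < k → a i ≡ b i) → ¬ ¬ (∃[ j ] a k ≡ b j) → ¬ a k < b k
strictlyIncreasing-≮ {k} {a} {b} a↑ b↑ agree inImage ak<bk = inImage (λ (j , ak≡bj) → noPreimage j ak≡bj)
  where
  noPreimage : ∀ j → a k ≢ b j
  noPreimage j ak≡bj with j <? k
  ... | yes j<k = <-irrefl (trans (agree j<k) (sym ak≡bj)) (strictlyIncreasing-< a↑ j<k)
  ... | no j≮k = <⇒≱ ak<bk (subst (b k ≤_) (sym ak≡bj) (strictlyIncreasing-≤ b↑ (≮⇒≥ j≮k)))

strictlyIncreasing-sameImage⇒≡ : {a b : ℕ → ℕ} → StrictlyIncreasing a → StrictlyIncreasing b →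
                                 (∀ i → ¬ ¬ (∃[ j ] a i ≡ b j)) → (∀ i → ¬ ¬ (∃[ j ] b i ≡ a j)) →
                                 ∀ k → a k ≡ b k
strictlyIncreasing-sameImage⇒≡ {a} {b} a↑ b↑ a⊆b b⊆a = <-rec (λ k → a k ≡ b k) λ k agree →
  ≤-antisym (≮⇒≥ (strictlyIncreasing-≮ b↑ a↑ (λ i<k → sym (agree i<k)) (b⊆a k)))
            (≮⇒≥ (strictlyIncreasing-≮ a↑ b↑ agree (a⊆b k)))

^-monoʳ-∣ : ∀ p → m ≤ n → p ^ m ∣ p ^ n
^-monoʳ-∣ p m≤n = go (≤⇒≤′ m≤n)
  where
  go : m ≤′ n → p ^ m ∣ p ^ n
  go ≤′-refl = ∣-refl
  go (≤′-step m≤n) = ∣-trans (go m≤n) (n∣m*n p)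

LeadingIndex : (ℕ → ℕ) → ℕ → Set
LeadingIndex δ j = δ j ≢ 0 × (∀ {k} → k < j → δ k ≡ 0)

leadingIndex-suc : ∀ {δ} → δ 0 ≡ 0 → LeadingIndex (δ ∘ suc) j → LeadingIndex δ (suc j)
leadingIndex-suc {j} {δ} δ₀≡0 (δ₁₊ⱼ≢0 , before) = δ₁₊ⱼ≢0 , before′
  where
  before′ : ∀ {k} → k < suc j → δ k ≡ 0
  before′ {zero} _ = δ₀≡0
  before′ {suc k} (s≤s k<j) = before k<j

leadingIndex-exists : (δ : ℕ → ℕ) → δ k ≢ 0 → ∃ (LeadingIndex δ)
leadingIndex-exists {zero} δ δ₀≢0 = zero , δ₀≢0 , λ ()
leadingIndex-exists {suc k} δ δ₁₊ₖ≢0 with δ 0 ≟ 0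
... | no δ₀≢0 = zero , δ₀≢0 , λ ()
... | yes δ₀≡0 with leadingIndex-exists (δ ∘ suc) δ₁₊ₖ≢0
...   | j , lead = suc j , leadingIndex-suc δ₀≡0 lead

β-leadingIndex : ∀ i → LeadingIndex (β i) i
β-leadingIndex zero = (λ ()) , λ ()
β-leadingIndex (suc i) = leadingIndex-suc refl (β-leadingIndex i)

module _ {p : ℕ} .{{_ : NonZero p}} where

  sumBelow-∣ : ∀ {d} f N → (∀ {k} → k < N → d ∣ f k) → d ∣ sumBelow {p} N f
  sumBelow-∣ f zero _ = _ ∣0
  sumBelow-∣ f (suc N) all∣ = ∣m∣n⇒∣m+n (sumBelow-∣ f N (λ k<N → all∣ (m<n⇒m<1+n k<N))) (all∣ ≤-refl)

  sumBelow-∣-single : ∀ {d} f N → j < N → (∀ {k} → k < j → d ∣ f k) → (∀ {k} → j < k → d ∣ f k) →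
                      d ∣ sumBelow {p} N f → d ∣ f j
  sumBelow-∣-single {j} {d} f (suc N) j<1+N before after ∣sum with m<1+n⇒m<n∨m≡n j<1+N
  ... | inj₁ j<N = sumBelow-∣-single f N j<N before after
                     (∣m+n∣m⇒∣n (subst (d ∣_) (+-comm (sumBelow {p} N f) (f N)) ∣sum) (after j<N))
  ... | inj₂ refl = ∣m+n∣m⇒∣n ∣sum (sumBelow-∣ f j before)

  module _ {m : ℕ} where
    private instance
      p^m-nonZero : NonZero (p ^ m)
      p^m-nonZero = m^n≢0 p m

    res-mod : ∀ (x : ℤ[ p ]) → m ≤ n → res x n % p ^ m ≡ res x m
    res-mod x m≤n = go (≤⇒≤′ m≤n)
      where
      open ≡-Reasoning
      go : m ≤′ n → res x n % p ^ m ≡ res x m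
      go ≤′-refl = m<n⇒m%n≡m (res-lt x m)
      go (≤′-step {n} m≤n) = begin
        res x (suc n) % p ^ m         ≡⟨ m∣n⇒o%n%m≡o%m (p ^ m) (p ^ n) _ (^-monoʳ-∣ p (≤′⇒≤ m≤n)) ⟨
        res x (suc n) % p ^ n % p ^ m ≡⟨ cong (_% p ^ m) (res-coh x n) ⟩
        res x n % p ^ m               ≡⟨ go m≤n ⟩
        res x m                       ∎
        where instance _ = m^n≢0 p n

    ∣ₚ⇔^∣res : ∀ (x : ℤ[ p ]) → m ≤ n → m ∣ₚ x ⇔ p ^ m ∣ res x n
    ∣ₚ⇔^∣res x m≤n = mk⇔
      (λ m∣x → ∣n∣m%n⇒∣m ∣-refl (subst (_ ∣_) (sym (res-mod x m≤n)) m∣x))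
      (λ ∣res → subst (_ ∣_) (res-mod x m≤n) (%-presˡ-∣ ∣res ∣-refl))

  ∣ₚ-weaken : ∀ (x : ℤ[ p ]) → m ≤ n → n ∣ₚ x → m ∣ₚ x
  ∣ₚ-weaken x m≤n n∣x = Equivalence.from (∣ₚ⇔^∣res x m≤n) (∣-trans (^-monoʳ-∣ p m≤n) n∣x)

  ∣ₚ⇒≤ord : ∀ (x : ℤ[ p ]) → HasOrd x m → n ∣ₚ x → n ≤ m
  ∣ₚ⇒≤ord {m} {n} x (_ , m+1∤x) n∣x with m <? n
  ... | yes m<n = contradiction (∣ₚ-weaken x m<n n∣x) m+1∤x
  ... | no m≮n = ≮⇒≥ m≮n

  HasOrd-unique : ∀ (x : ℤ[ p ]) → HasOrd x m → HasOrd x n → m ≡ n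
  HasOrd-unique x ordₘ ordₙ = ≤-antisym (∣ₚ⇒≤ord x ordₙ (proj₁ ordₘ)) (∣ₚ⇒≤ord x ordₘ (proj₁ ordₙ))

  HasOrd-⇔ : ∀ (x y : ℤ[ p ]) {a b} → HasOrd x a → HasOrd y b → a ≡ b → ∀ m → HasOrd x m ⇔ HasOrd y m
  HasOrd-⇔ x y ordₐ ordₐ′ refl m = mk⇔
    (λ ordₘ → subst (HasOrd y) (HasOrd-unique x ordₐ ordₘ) ordₐ′)
    (λ ordₘ → subst (HasOrd x) (HasOrd-unique y ordₐ′ ordₘ) ordₐ)

  module _ (Q : ℕ → ℤ[ p ]) (Q↓ : Decreasing Q) where

    ord : ℕ → ℕ
    ord k = proj₁ (Q↓ k)

    ord-HasOrd : ∀ k → HasOrd (Q k) (ord k)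
    ord-HasOrd k = proj₁ (proj₂ (Q↓ k))

    ord-strictlyIncreasing : StrictlyIncreasing ord
    ord-strictlyIncreasing k = ∣ₚ⇒≤ord (Q (suc k)) (ord-HasOrd (suc k)) (proj₂ (proj₂ (Q↓ k)))

  record SeriesHasOrd (δ : ℕ → ℕ) (Q : ℕ → ℤ[ p ]) (m : ℕ) : Set where
    constructor seriesHasOrd
    field
      vanishes : ∀ {n} → n ≤ m → seriesRes δ Q n ≡ 0
      nonvanishing : seriesRes δ Q (suc m) ≢ 0

  SeriesHasOrd-≮ : ∀ {δ δ′ Q Z} → SeriesEq δ Q δ′ Z → SeriesHasOrd δ Q m → SeriesHasOrd δ′ Z n → ¬ m < n
  SeriesHasOrd-≮ {m} Σ≡Σ′ (seriesHasOrd _ Σ≢0) (seriesHasOrd Σ′≡0 _) m<n = Σ≢0 (trans (Σ≡Σ′ (suc m)) (Σ′≡0 m<n))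

  SeriesHasOrd-unique : ∀ {δ δ′ Q Z} → SeriesEq δ Q δ′ Z → SeriesHasOrd δ Q m → SeriesHasOrd δ′ Z n → m ≡ n
  SeriesHasOrd-unique Σ≡Σ′ ordₘ ordₙ =
    ≤-antisym (≮⇒≥ (SeriesHasOrd-≮ (λ n → sym (Σ≡Σ′ n)) ordₙ ordₘ)) (≮⇒≥ (SeriesHasOrd-≮ Σ≡Σ′ ordₘ ordₙ))

  module _ (p-prime : Prime p) where

    HasOrd⇒∤unit*res : ∀ {d} (x : ℤ[ p ]) → d ≢ 0 → d < p → HasOrd x m → ¬ p ^ suc m ∣ d * res x (suc m)
    HasOrd⇒∤unit*res {m} {d} x d≢0 d<p (m∣x , m+1∤x) ∣d*res
      with Equivalence.to (∣ₚ⇔^∣res x (n≤1+n m)) m∣x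
    ... | divides c res≡c*p^m with euclidsLemma d c p-prime p∣d*c
      where
      instance _ = m^n≢0 p m
      p∣d*c : p ∣ d * c
      p∣d*c = *-cancelʳ-∣ (p ^ m)
        (subst (p ^ suc m ∣_) (trans (cong (d *_) res≡c*p^m) (sym (*-assoc d c (p ^ m)))) ∣d*res)
    ... | inj₁ p∣d = <⇒≱ d<p (∣⇒≤ {{≢-nonZero d≢0}} p∣d)
    ... | inj₂ p∣c = m+1∤x (subst (p ^ suc m ∣_) (sym res≡c*p^m) (*-monoˡ-∣ (p ^ m) p∣c))

    seriesHasOrd-leadingIndex : ∀ {δ} Z (Z↓ : Decreasing Z) → LeadingIndex δ j → δ j < p →
                                SeriesHasOrd δ Z (ord Z Z↓ j)
    seriesHasOrd-leadingIndex {j} {δ} Z Z↓ (δⱼ≢0 , δ<ⱼ≡0) δⱼ<p = seriesHasOrd vanishes nonvanishing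
      where
      b : ℕ → ℕ
      b = ord Z Z↓

      b↑ : StrictlyIncreasing b
      b↑ = ord-strictlyIncreasing Z Z↓

      term : ℕ → ℕ → ℕ
      term n k = δ k * res (Z k) n

      term-∣-before : ∀ {d n k} → k < j → d ∣ term n k
      term-∣-before k<j rewrite δ<ⱼ≡0 k<j = _ ∣0

      term-∣ : ∀ {n k} → n ≤ b k → p ^ n ∣ term n k
      term-∣ {n} {k} n≤bₖ = ∣-trans (∣ₚ-weaken (Z k) n≤bₖ (proj₁ (ord-HasOrd Z Z↓ k))) (n∣m*n (δ k))

      vanishes : ∀ {n} → n ≤ b j → seriesRes δ Z n ≡ 0
      vanishes {n} n≤bⱼ = n∣m⇒m%n≡0 _ _ {{m^n≢0 p n}} (sumBelow-∣ (term n) n all∣)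
        where
        all∣ : ∀ {k} → k < n → p ^ n ∣ term n k
        all∣ {k} _ with k <? j
        ... | yes k<j = term-∣-before k<j
        ... | no k≮j = term-∣ (≤-trans n≤bⱼ (strictlyIncreasing-≤ b↑ (≮⇒≥ k≮j)))

      nonvanishing : seriesRes δ Z (suc (b j)) ≢ 0
      nonvanishing Σ≡0 = HasOrd⇒∤unit*res (Z j) δⱼ≢0 δⱼ<p (ord-HasOrd Z Z↓ j)
        (sumBelow-∣-single (term (suc (b j))) (suc (b j)) (s≤s (strictlyIncreasing-≥id b↑ j)) term-∣-before
           (λ j<k → term-∣ (strictlyIncreasing-< b↑ j<k))
           (m%n≡0⇒n∣m _ _ {{m^n≢0 p (suc (b j))}} Σ≡0))

    ord-inImage : ∀ {E} → (∀ i → E (β i)) → (∀ ε → E ε → ∀ k → ε k < p) →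
                  ∀ Q (Q↓ : Decreasing Q) Z (Z↓ : Decreasing Z) → XSubset E Q Z →
                  ∀ i → ¬ ¬ (∃[ j ] ord Q Q↓ i ≡ ord Z Z↓ j)
    ord-inImage Eβ bounded Q Q↓ Z Z↓ Q⊆Z i noPreimage with Q⊆Z (β i) (Eβ i) (λ β≡0 → proj₁ (β-leadingIndex i) (β≡0 i))
    ... | δ , Eδ , δ≢0 , Qᵢ≡Σδ = δ≢0 λ k → decidable-stable (δ k ≟ 0) λ δₖ≢0 →
      let j , lead = leadingIndex-exists δ δₖ≢0 in
      noPreimage (j , SeriesHasOrd-unique Qᵢ≡Σδ
        (seriesHasOrd-leadingIndex Q Q↓ (β-leadingIndex i) (bounded (β i) (Eβ i) i))
        (seriesHasOrd-leadingIndex Z Z↓ lead (bounded δ Eδ j)))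

lemma5p13 : (p : ℕ) .{{_ : NonZero p}} → Prime p →
    (E : (ℕ → ℕ) → Set) →
    (∀ ε ε′ → (∀ k → ε k ≡ ε′ k) → E ε → E ε′) →
    E (λ _ → 0) → (∀ i → E (β i)) →
    (∀ ε → E ε → ∀ k → ε k < p) →
    (Q Z : ℕ → ℤ[ p ]) → Decreasing Q → Decreasing Z →
    XSubset E Q Z × XSubset E Z Q →
    ∀ k m → HasOrd (Q k) m ⇔ HasOrd (Z k) m
lemma5p13 p p-prime E _ _ Eβ bounded Q Z Q↓ Z↓ (Q⊆Z , Z⊆Q) k m =
  HasOrd-⇔ (Q k) (Z k) (ord-HasOrd Q Q↓ k) (ord-HasOrd Z Z↓ k) ordQ≡ordZ m
  where
  ordQ≡ordZ : ord Q Q↓ k ≡ ord Z Z↓ k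
  ordQ≡ordZ = strictlyIncreasing-sameImage⇒≡
    (ord-strictlyIncreasing Q Q↓) (ord-strictlyIncreasing Z Z↓)
    (ord-inImage p-prime Eβ bounded Q Q↓ Z Z↓ Q⊆Z) (ord-inImage p-prime Eβ bounded Z Z↓ Q Q↓ Z⊆Q) k
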